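{- There exists an infinite family of DAGs $G=(V,E)$ with $|V|$ unbounded, each of width $\alpha_1=2$, such that on each of them (an execution of) the greedy chain partition algorithm outputs at least $\alpha_1\log_4(|V|)=2\log_4(|V|)$ chains. Likewise, there exists an infinite family of DAGs $G=(V,E)$ with $|V|$ unbounded, each of height $\beta_1=2$, such that on each of them (an execution of) the greedy antichain partition algorithm outputs at least $\beta_1\log_4(|V|)=2\log_4(|V|)$ antichains.
   Context: Let $G=(V,E)$ be a directed acyclic graph. A chain is a set of vertices that occur, in order, as a subsequence of the vertices of some directed path of $G$. An antichain is a set of vertices that are pairwise unreachable from one another. The width $\alpha_1$ is the maximum size of an antichain, which equals the minimum number of chains in a partition of $V$ into chains (MCP). The height $\beta_1$ is the maximum size of a chain, which equals the minimum number of antichains in a partition of $V$ into antichains (MAP). The greedy chain partition algorithm maintains the set $U$ of uncovered vertices (initially $U=V$) and, while $U\neq\emptyset$, selects a chain $C\subseteq U$ of maximum size (ties broken arbitrarily), outputs it and removes it from $U$; the greedy antichain partition algorithm is identical with antichains in place of chains. -}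

module Defs where

open import Data.Nat using (ℕ; _≤_; _^_)
open import Data.Bool using (Bool; true)
open import Data.Fin using (Fin)
open import Data.Fin.Subset using (Subset; _∈_; _⊆_; _─_; ∣_∣; Nonempty; Empty; ⊤)
open import Data.List using (List; []; _∷_; length)
import Data.List.Membership.Propositional as L
open import Data.List.Relation.Unary.Linked using (Linked)
open import Data.Product using (Σ; _×_; ∃; _,_)
open import Relation.Binary.PropositionalEquality using (_≡_)
open import Relation.Binary.Construct.Closure.Transitive using (TransClosure)
open import Relation.Binary.Construct.Closure.ReflexiveTransitive using (Star)
open import Relation.Nullary using (¬_)

Graph : ℕ → Set
Graph n = Fin n → Fin n → Bool

module _ {n : ℕ} (G : Graph n) where

  Edge : Fin n → Fin n → Set
  Edge u v = G u v ≡ true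

  Reach : Fin n → Fin n → Set
  Reach = Star Edge

  IsDAG : Set
  IsDAG = ∀ v → ¬ TransClosure Edge v v

  IsPath : List (Fin n) → Set
  IsPath = Linked Edge

  IsChain : Subset n → Set
  IsChain C = Σ (List (Fin n)) λ p → IsPath p × (∀ v → v ∈ C → v L.∈ p)

  IsAntichain : Subset n → Set
  IsAntichain A = ∀ u v → u ∈ A → v ∈ A → ¬ u ≡ v → ¬ Reach u v

  WidthIs : ℕ → Set
  WidthIs k = (Σ (Subset n) λ A → IsAntichain A × ∣ A ∣ ≡ k)
            × (∀ A → IsAntichain A → ∣ A ∣ ≤ k)

  HeightIs : ℕ → Set
  HeightIs k = (Σ (Subset n) λ C → IsChain C × ∣ C ∣ ≡ k)
             × (∀ C → IsChain C → ∣ C ∣ ≤ k)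

  -- An execution of the greedy partition algorithm w.r.t. a family P
  -- (chains or antichains): GreedyRun P U cs means that starting from the
  -- uncovered set U, the algorithm may output exactly the sets cs, in order.
  data GreedyRun (P : Subset n → Set) : Subset n → List (Subset n) → Set where
    done : ∀ {U} → Empty U → GreedyRun P U []
    step : ∀ {U C cs} → Nonempty U → C ⊆ U → P C
         → (∀ D → D ⊆ U → P D → ∣ D ∣ ≤ ∣ C ∣)
         → GreedyRun P (U ─ C) cs → GreedyRun P U (C ∷ cs)

  GreedyChainRun : List (Subset n) → Set
  GreedyChainRun = GreedyRun IsChain ⊤

  GreedyAntichainRun : List (Subset n) → Set
  GreedyAntichainRun = GreedyRun IsAntichain ⊤

-- Take the vertices 0, …, 2 ^ k − 1, cut into the dyadic blocks {0} and [2 ^ j, 2 ^ (j + 1)),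
-- and call a and 2 ^ j + a (for a < 2 ^ j) twins. In the two DAGs used, every block is a chain
-- (resp. an antichain) while any two twins are incomparable (resp. adjacent). So a chain
-- (antichain) inside [0, 2 ^ (j + 1)) contains no pair of twins and has at most 2 ^ j elements,
-- which lets the greedy algorithm remove the blocks from the top down: k + 1 sets for 2 ^ k
-- vertices.
--
-- Chains: u precedes v if popcount u ≥ popcount v + 2, or popcount u ≥ popcount v and u comes
-- first in the order by (bit length, − popcount, value). Twins have popcounts differing by one,
-- hence are incomparable, while numbers whose popcounts have the same parity are comparable:
-- the width is 2.
-- Antichains: twins are joined by an edge directed from even to odd popcount. Every edge goes
-- from even to odd, so no path has two edges: the height is 2.
module Submission where

open import Defs
open import Data.Nat
  using (ℕ; zero; suc; _+_; _∸_; _^_; _≤_; _<_; z≤n; s≤s; s≤s⁻¹; z<s; _<ᵇ_; _≟_; _≤?_; _<?_)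
open import Data.Nat.Properties
open import Data.Bool using (Bool; true; false; not; _∧_; T)
open import Data.Fin using (Fin; zero; suc; toℕ; fromℕ<; punchOut)
import Data.Fin.Properties as Fin
open import Data.Fin.Subset using (Subset; _∈_; _⊆_; _─_; ∣_∣; ⊤; Empty; inside; outside)
open import Data.Fin.Subset.Properties using (p⊆q⇒∣p∣≤∣q∣; _∈?_)
open import Data.List using (List; []; _∷_; length; foldr; filter; allFin)
open import Data.List.Membership.Propositional using () renaming (_∈_ to _∈ₗ_)
open import Data.List.Membership.Propositional.Properties using (∈-filter⁺; ∈-allFin)
open import Data.List.Relation.Unary.All using (All; []; _∷_)
open import Data.List.Relation.Unary.All.Properties using (all-filter)
open import Data.List.Relation.Unary.Any using (here; there)
open import Data.List.Relation.Unary.Linked using ([]; [-]; _∷_)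
import Data.List.Relation.Unary.Linked as Linked
open import Data.Product using (Σ; ∃; _×_; _,_; proj₁; proj₂; uncurry)
open import Data.Sum using (_⊎_; inj₁; inj₂)
import Data.Sum as Sum
open import Data.Vec using ([]; _∷_; tabulate)
import Data.Vec as Vec
open import Data.Vec.Properties using (lookup∘tabulate; []=⇒lookup; lookup⇒[]=)
open import Data.Empty using (⊥-elim)
open import Function using (_∘_; case_of_)
open import Relation.Binary.Definitions using (Decidable; Transitive; tri<; tri≈; tri>)
open import Relation.Binary.Construct.Closure.ReflexiveTransitive using (ε; _◅_)
open import Relation.Binary.Construct.Closure.Transitive using (TransClosure; [_]; _∷_)
open import Relation.Binary.PropositionalEquality
  using (_≡_; _≢_; refl; sym; trans; cong; subst; module ≡-Reasoning)
open import Relation.Nullary using (¬_; Dec; yes; no; does; contradiction)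
open import Relation.Nullary.Decidable using (_×-dec_; _⊎-dec_; map′)

-- Powers of two and twins

2^[1+j]≡2^j+2^j : ∀ j → 2 ^ suc j ≡ 2 ^ j + 2 ^ j
2^[1+j]≡2^j+2^j j = cong (2 ^ j +_) (+-identityʳ (2 ^ j))

2^[1+j]∸2^j≡2^j : ∀ j → 2 ^ suc j ∸ 2 ^ j ≡ 2 ^ j
2^[1+j]∸2^j≡2^j j = trans (cong (_∸ 2 ^ j) (2^[1+j]≡2^j+2^j j)) (m+n∸m≡n (2 ^ j) (2 ^ j))

2^-reflects-< : ∀ {m n} → 2 ^ m < 2 ^ n → m < n
2^-reflects-< 2^m<2^n = ≰⇒> (λ n≤m → <⇒≱ 2^m<2^n (^-monoʳ-≤ 2 n≤m))

n<2^n : ∀ n → n < 2 ^ n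
n<2^n zero    = z<s
n<2^n (suc n) = ≤-<-trans (n<2^n n) (^-monoʳ-< 2 (s≤s (s≤s z≤n)) (n<1+n n))

data IsTwin (j : ℕ) : ℕ → ℕ → Set where
  twin : ∀ {a} → a < 2 ^ j → IsTwin j a (2 ^ j + a)

isTwin? : ∀ j a b → Dec (IsTwin j a b)
isTwin? j a b with a <? 2 ^ j | b ≟ 2 ^ j + a
... | yes a<2^j | yes refl = yes (twin a<2^j)
... | no a≮2^j  | _        = no λ { (twin a<2^j) → a≮2^j a<2^j }
... | _         | no b≢    = no λ { (twin _) → b≢ refl }

twin-< : ∀ {j a b} → IsTwin j a b → b < 2 ^ suc j
twin-< {j} {a} (twin a<2^j) =
  subst (2 ^ j + a <_) (sym (2^[1+j]≡2^j+2^j j)) (+-monoʳ-< (2 ^ j) a<2^j)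

twin-≢ : ∀ {j a b} → IsTwin j a b → a ≢ b
twin-≢ {j} {a} (twin _) a≡ = <-irrefl a≡ (m<n+m a (m^n>0 2 j))

twin-escapes-block : ∀ j {i a b} → 2 ^ j ≤ a → b < 2 ^ suc j → ¬ IsTwin i a b
twin-escapes-block j {i} {a} 2^j≤a b<2^[1+j] (twin a<2^i) =
  <⇒≱ b<2^[1+j] (≤-trans (^-monoʳ-≤ 2 j<i) (m≤m+n (2 ^ i) a))
  where
  j<i : j < i
  j<i = 2^-reflects-< (≤-<-trans 2^j≤a a<2^i)

data Halves (j : ℕ) : ℕ → Set where
  lower : ∀ {a} → a < 2 ^ j → Halves j a
  upper : ∀ {a} → a < 2 ^ j → Halves j (2 ^ j + a)

halves : ∀ j {x} → x < 2 ^ suc j → Halves j x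
halves j {x} x<2^[1+j] with x <? 2 ^ j
... | yes x<2^j = lower x<2^j
... | no x≮2^j  = subst (Halves j) x≡ (upper (+-cancelˡ-< (2 ^ j) _ _ (begin-strict
      2 ^ j + (x ∸ 2 ^ j) ≡⟨ x≡ ⟩
      x                   <⟨ x<2^[1+j] ⟩
      2 ^ suc j           ≡⟨ 2^[1+j]≡2^j+2^j j ⟩
      2 ^ j + 2 ^ j       ∎)))
  where
  open ≤-Reasoning
  x≡ : 2 ^ j + (x ∸ 2 ^ j) ≡ x
  x≡ = m+[n∸m]≡n (≮⇒≥ x≮2^j)

lowBits : ∀ {j x} → Halves j x → Fin (2 ^ j)
lowBits (lower a<2^j) = fromℕ< a<2^j
lowBits (upper a<2^j) = fromℕ< a<2^j

lowBits-collision : ∀ {j x y} (hx : Halves j x) (hy : Halves j y) → lowBits hx ≡ lowBits hy →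
                    x ≡ y ⊎ IsTwin j x y ⊎ IsTwin j y x
lowBits-collision (lower a<) (lower b<) e = inj₁ (Fin.fromℕ<-injective _ _ a< b< e)
lowBits-collision (upper a<) (upper b<) e with Fin.fromℕ<-injective _ _ a< b< e
... | refl = inj₁ refl
lowBits-collision (lower a<) (upper b<) e with Fin.fromℕ<-injective _ _ a< b< e
... | refl = inj₂ (inj₁ (twin a<))
lowBits-collision (upper a<) (lower b<) e with Fin.fromℕ<-injective _ _ b< a< (sym e)
... | refl = inj₂ (inj₂ (twin b<))

below2-twins : ∀ {a b} → a < 2 → b < 2 → a ≢ b → IsTwin 0 a b ⊎ IsTwin 0 b a
below2-twins {0}           {0}           _ _ a≢b = contradiction refl a≢b
below2-twins {0}           {1}           _ _ _   = inj₁ (twin z<s)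
below2-twins {1}           {0}           _ _ _   = inj₂ (twin z<s)
below2-twins {1}           {1}           _ _ a≢b = contradiction refl a≢b
below2-twins {suc (suc _)} {_}           (s≤s (s≤s ())) _ _
below2-twins {_}           {suc (suc _)} _ (s≤s (s≤s ())) _

parity : ℕ → Fin 2
parity zero          = zero
parity (suc zero)    = suc zero
parity (suc (suc n)) = parity n

parity-suc : ∀ n → (parity n ≡ zero × parity (suc n) ≡ suc zero) ⊎
                   (parity n ≡ suc zero × parity (suc n) ≡ zero)
parity-suc zero          = inj₁ (refl , refl)
parity-suc (suc zero)    = inj₂ (refl , refl)
parity-suc (suc (suc n)) = parity-suc n

parity-suc≢ : ∀ n → parity n ≢ parity (suc n)
parity-suc≢ n e with parity-suc n
... | inj₁ (p , q) = Fin.0≢1+n (trans (sym p) (trans e q))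
... | inj₂ (p , q) = Fin.0≢1+n (trans (sym q) (trans (sym e) p))

parity-<⇒2+≤ : ∀ {m n} → parity m ≡ parity n → m < n → 2 + m ≤ n
parity-<⇒2+≤ {m} e m<n with m≤n⇒m<n∨m≡n m<n
... | inj₁ 2+m≤n = 2+m≤n
... | inj₂ refl  = contradiction e (parity-suc≢ m)

parity-gap : ∀ {a b} → parity a ≡ parity b → a ≡ b ⊎ 2 + a ≤ b ⊎ 2 + b ≤ a
parity-gap {a} {b} e with <-cmp a b
... | tri< a<b _ _ = inj₂ (inj₁ (parity-<⇒2+≤ e a<b))
... | tri≈ _ a≡b _ = inj₁ a≡b
... | tri> _ _ b<a = inj₂ (inj₂ (parity-<⇒2+≤ (sym e) b<a))

popcount : ℕ → ℕ → ℕ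
popcount zero    v = 0
popcount (suc K) v with v <? 2 ^ K
... | yes _ = popcount K v
... | no _  = suc (popcount K (v ∸ 2 ^ K))

-- the binary length of v, for v < 2 ^ K
bitLength : ℕ → ℕ → ℕ
bitLength zero    v = 0
bitLength (suc K) v with v <? 2 ^ K
... | yes _ = bitLength K v
... | no _  = suc K

module _ (K : ℕ) {v : ℕ} (v<2^K : v < 2 ^ K) where

  popcount-low : popcount (suc K) v ≡ popcount K v
  popcount-low with v <? 2 ^ K
  ... | yes _    = refl
  ... | no v≮2^K = contradiction v<2^K v≮2^K

  bitLength-low : bitLength (suc K) v ≡ bitLength K v
  bitLength-low with v <? 2 ^ K
  ... | yes _    = refl
  ... | no v≮2^K = contradiction v<2^K v≮2^K

module _ (K r : ℕ) where

  private
    2^K+r≮2^K : ¬ 2 ^ K + r < 2 ^ K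
    2^K+r≮2^K = ≤⇒≯ (m≤m+n (2 ^ K) r)

  popcount-high : popcount (suc K) (2 ^ K + r) ≡ suc (popcount K r)
  popcount-high with 2 ^ K + r <? 2 ^ K
  ... | yes lt = contradiction lt 2^K+r≮2^K
  ... | no _   = cong (suc ∘ popcount K) (m+n∸m≡n (2 ^ K) r)

  bitLength-high : bitLength (suc K) (2 ^ K + r) ≡ suc K
  bitLength-high with 2 ^ K + r <? 2 ^ K
  ... | yes lt = contradiction lt 2^K+r≮2^K
  ... | no _   = refl

bitLength-≤ : ∀ K {j a} → a < 2 ^ j → bitLength K a ≤ j
bitLength-≤ zero    a<2^j = z≤n
bitLength-≤ (suc K) {a = a} a<2^j with a <? 2 ^ K
... | yes _    = bitLength-≤ K a<2^j
... | no a≮2^K = 2^-reflects-< (≤-<-trans (≮⇒≥ a≮2^K) a<2^j)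

popcount-twin : ∀ K {j a b} → j < K → IsTwin j a b → popcount K b ≡ suc (popcount K a)
popcount-twin (suc K) {j} {a} j<1+K t@(twin a<2^j) with m≤n⇒m<n∨m≡n (s≤s⁻¹ j<1+K)
... | inj₁ j<K = begin
  popcount (suc K) (2 ^ j + a) ≡⟨ popcount-low K (<-≤-trans (twin-< t) 2^[1+j]≤2^K) ⟩
  popcount K (2 ^ j + a)       ≡⟨ popcount-twin K j<K t ⟩
  suc (popcount K a)           ≡⟨ cong suc (popcount-low K (<-≤-trans a<2^j 2^j≤2^K)) ⟨
  suc (popcount (suc K) a)     ∎
  where
  open ≡-Reasoning
  2^[1+j]≤2^K : 2 ^ suc j ≤ 2 ^ K
  2^[1+j]≤2^K = ^-monoʳ-≤ 2 j<K
  2^j≤2^K : 2 ^ j ≤ 2 ^ K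
  2^j≤2^K = ^-monoʳ-≤ 2 (<⇒≤ j<K)
... | inj₂ refl = trans (popcount-high j a) (cong suc (sym (popcount-low j a<2^j)))

bitLength-twin : ∀ K {j a b} → j < K → IsTwin j a b → bitLength K b ≡ suc j
bitLength-twin (suc K) {j} j<1+K t@(twin a<2^j) with m≤n⇒m<n∨m≡n (s≤s⁻¹ j<1+K)
... | inj₁ j<K  =
  trans (bitLength-low K (<-≤-trans (twin-< t) (^-monoʳ-≤ 2 j<K))) (bitLength-twin K j<K t)
... | inj₂ refl = bitLength-high j _

bitLength-block : ∀ K {j a} → j < K → 2 ^ j ≤ a → a < 2 ^ suc j → bitLength K a ≡ suc j
bitLength-block K {j} j<K 2^j≤a a<2^[1+j] with halves j a<2^[1+j]
... | lower a<2^j = contradiction a<2^j (≤⇒≯ 2^j≤a)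
... | upper r<2^j = bitLength-twin K j<K (twin r<2^j)

injectiveOn⇒∣p∣≤ : ∀ {n h} (D : Subset n) (f : ∀ {v} → v ∈ D → Fin h) →
                   (∀ {u v} (p : u ∈ D) (q : v ∈ D) → f p ≡ f q → u ≡ v) → ∣ D ∣ ≤ h
injectiveOn⇒∣p∣≤ []            f f-inj = z≤n
injectiveOn⇒∣p∣≤ (outside ∷ D) f f-inj =
  injectiveOn⇒∣p∣≤ D (f ∘ Vec.there) (λ p q → Fin.suc-injective ∘ f-inj (Vec.there p) (Vec.there q))
injectiveOn⇒∣p∣≤ {h = zero}  (inside ∷ D) f f-inj with f Vec.here
... | ()
injectiveOn⇒∣p∣≤ {h = suc h} (inside ∷ D) f f-inj = s≤s (injectiveOn⇒∣p∣≤ D f′ f′-inj)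
  where
  f′ : ∀ {v} → v ∈ D → Fin h
  f′ p = punchOut (λ e → Fin.0≢1+n (f-inj Vec.here (Vec.there p) e))
  f′-inj : ∀ {u v} (p : u ∈ D) (q : v ∈ D) → f′ p ≡ f′ q → u ≡ v
  f′-inj p q e = Fin.suc-injective (f-inj (Vec.there p) (Vec.there q)
                                          (Fin.punchOut-injective {i = f Vec.here} _ _ e))

module _ {n : ℕ} {f : Fin n → Bool} {v : Fin n} where

  ∈-tabulate⁻ : v ∈ tabulate f → f v ≡ true
  ∈-tabulate⁻ v∈ = trans (sym (lookup∘tabulate f v)) ([]=⇒lookup v∈)

  ∈-tabulate⁺ : f v ≡ true → v ∈ tabulate f
  ∈-tabulate⁺ fv = lookup⇒[]= v (tabulate f) (trans (lookup∘tabulate f v) fv)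

<ᵇ≡true⇒< : ∀ {m n} → (m <ᵇ n) ≡ true → m < n
<ᵇ≡true⇒< {m} {n} e = <ᵇ⇒< m n (subst T (sym e) _)

<ᵇ≡false⇒≥ : ∀ {m n} → (m <ᵇ n) ≡ false → n ≤ m
<ᵇ≡false⇒≥ e = ≮⇒≥ (λ m<n → subst T e (<⇒<ᵇ m<n))

interval : ∀ {n} → ℕ → ℕ → Subset n
interval a b = tabulate λ v → not (toℕ v <ᵇ a) ∧ (toℕ v <ᵇ b)

prefix : ∀ {n} → ℕ → Subset n
prefix = interval 0

dyadicBlock : ∀ {n} → ℕ → Subset n
dyadicBlock j = interval (2 ^ j) (2 ^ suc j)

-- a and b are explicit: interval is not injective, so they cannot be inferred
module _ {n : ℕ} (a b : ℕ) {v : Fin n} where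

  ∈-interval⁻ : v ∈ interval a b → a ≤ toℕ v × toℕ v < b
  ∈-interval⁻ v∈ with toℕ v <ᵇ a in v≮a | toℕ v <ᵇ b in v<b | ∈-tabulate⁻ v∈
  ... | false | true | _ = <ᵇ≡false⇒≥ v≮a , <ᵇ≡true⇒< v<b

  ∈-interval⁺ : a ≤ toℕ v → toℕ v < b → v ∈ interval a b
  ∈-interval⁺ a≤v v<b = ∈-tabulate⁺ member
    where
    member : (not (toℕ v <ᵇ a) ∧ (toℕ v <ᵇ b)) ≡ true
    member with toℕ v <ᵇ a in v<ᵇa | toℕ v <ᵇ b in v<ᵇb
    ... | true  | _     = contradiction (<ᵇ≡true⇒< v<ᵇa) (≤⇒≯ a≤v)
    ... | false | true  = refl
    ... | false | false = contradiction v<b (≤⇒≯ (<ᵇ≡false⇒≥ v<ᵇb))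

∣interval∣ : ∀ n {a b} → a ≤ b → b ≤ n → ∣ interval {n} a b ∣ ≡ b ∸ a
∣interval∣ zero    {zero}  {zero}  _         _         = refl
∣interval∣ (suc n) {zero}  {zero}  _         _         = ∣interval∣ n z≤n z≤n
∣interval∣ (suc n) {zero}  {suc b} _         (s≤s b≤n) = cong suc (∣interval∣ n z≤n b≤n)
∣interval∣ (suc n) {suc a} {suc b} (s≤s a≤b) (s≤s b≤n) = ∣interval∣ n a≤b b≤n

prefix─interval : ∀ n {a b} → a ≤ b → prefix {n} b ─ interval a b ≡ prefix a
prefix─interval zero    _ = refl
prefix─interval (suc n) {zero}  {zero}  _         = cong (false ∷_) (prefix─interval n {0} {0} z≤n)
prefix─interval (suc n) {zero}  {suc b} _         = cong (false ∷_) (prefix─interval n {0} {b} z≤n)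
prefix─interval (suc n) {suc a} {suc b} (s≤s a≤b) = cong (true ∷_) (prefix─interval n a≤b)

⊤≡prefix : ∀ n → ⊤ ≡ prefix {n} n
⊤≡prefix zero    = refl
⊤≡prefix (suc n) = cong (true ∷_) (⊤≡prefix n)

prefix1-unique : ∀ {n} {u v : Fin n} → u ∈ prefix 1 → v ∈ prefix 1 → u ≡ v
prefix1-unique u∈ v∈ = Fin.toℕ-injective
  (trans (n<1⇒n≡0 (proj₂ (∈-interval⁻ 0 1 u∈))) (sym (n<1⇒n≡0 (proj₂ (∈-interval⁻ 0 1 v∈)))))

prefix2-twins : ∀ {n} {u v : Fin n} → u ∈ prefix 2 → v ∈ prefix 2 → u ≢ v →
                IsTwin 0 (toℕ u) (toℕ v) ⊎ IsTwin 0 (toℕ v) (toℕ u)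
prefix2-twins u∈ v∈ u≢v = below2-twins (proj₂ (∈-interval⁻ 0 2 u∈)) (proj₂ (∈-interval⁻ 0 2 v∈))
                                       (u≢v ∘ Fin.toℕ-injective)

TwinFree : ∀ {n} → ℕ → Subset n → Set
TwinFree j D = ∀ {u v} → u ∈ D → v ∈ D → ¬ IsTwin j (toℕ u) (toℕ v)

-- Folding the upper half of [0, 2 ^ (j + 1)) onto the lower half is injective on D.
twinFree⇒∣p∣≤2^j : ∀ {n j} {D : Subset n} → D ⊆ prefix (2 ^ suc j) → TwinFree j D → ∣ D ∣ ≤ 2 ^ j
twinFree⇒∣p∣≤2^j {j = j} {D} D⊆ twinFree = injectiveOn⇒∣p∣≤ D (lowBits ∘ view) view-injective
  where
  view : ∀ {v} → v ∈ D → Halves j (toℕ v)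
  view v∈ = halves j (proj₂ (∈-interval⁻ 0 (2 ^ suc j) (D⊆ v∈)))
  view-injective : ∀ {u v} (p : u ∈ D) (q : v ∈ D) → lowBits (view p) ≡ lowBits (view q) → u ≡ v
  view-injective p q e with lowBits-collision (view p) (view q) e
  ... | inj₁ u≡v      = Fin.toℕ-injective u≡v
  ... | inj₂ (inj₁ t) = ⊥-elim (twinFree p q t)
  ... | inj₂ (inj₂ t) = ⊥-elim (twinFree q p t)

-- Greedy runs that peel off dyadic blocks

module _ {n : ℕ} (G : Graph n) {P : Subset n → Set} where

  greedyRun-extend : ∀ {a b cs} → a < b → b ≤ n → P (interval a b) →
                     (∀ D → D ⊆ prefix b → P D → ∣ D ∣ ≤ b ∸ a) →
                     GreedyRun G P (prefix a) cs → GreedyRun G P (prefix b) (interval a b ∷ cs)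
  greedyRun-extend {a} {b} a<b b≤n P-block maximal run =
    step (fromℕ< a<n , ∈-interval⁺ 0 b z≤n (subst (_< b) (sym (Fin.toℕ-fromℕ< a<n)) a<b))
         (λ v∈ → ∈-interval⁺ 0 b z≤n (proj₂ (∈-interval⁻ a b v∈)))
         P-block
         (λ D D⊆ P-D → subst (∣ D ∣ ≤_) (sym (∣interval∣ n (<⇒≤ a<b) b≤n)) (maximal D D⊆ P-D))
         (subst (λ U → GreedyRun G P U _) (sym (prefix─interval n (<⇒≤ a<b))) run)
    where
    a<n : a < n
    a<n = <-≤-trans a<b b≤n

module _ {k : ℕ} (G : Graph (2 ^ k)) {P : Subset (2 ^ k) → Set}
         (P-prefix1 : P (prefix 1))
         (P-block : ∀ {j} → j < k → P (dyadicBlock j))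
         (P-twinFree : ∀ {j} → j < k → ∀ {D} → P D → TwinFree j D) where

  private
    prefix0-empty : Empty (prefix {2 ^ k} 0)
    prefix0-empty (v , v∈) = n≮0 (proj₂ (∈-interval⁻ 0 0 v∈))

    prefix1-maximal : ∀ D → D ⊆ prefix 1 → P D → ∣ D ∣ ≤ 1 ∸ 0
    prefix1-maximal D D⊆ _ =
      ≤-trans (p⊆q⇒∣p∣≤∣q∣ D⊆) (≤-reflexive (∣interval∣ (2 ^ k) z≤n (m^n>0 2 k)))

    block-maximal : ∀ {i} → i < k → ∀ D → D ⊆ prefix (2 ^ suc i) → P D → ∣ D ∣ ≤ 2 ^ suc i ∸ 2 ^ i
    block-maximal {i} i<k D D⊆ P-D =
      subst (∣ D ∣ ≤_) (sym (2^[1+j]∸2^j≡2^j i)) (twinFree⇒∣p∣≤2^j D⊆ (P-twinFree i<k P-D))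

  greedyRun-dyadicPrefix : ∀ i → i ≤ k →
    Σ (List (Subset (2 ^ k))) λ cs → GreedyRun G P (prefix (2 ^ i)) cs × length cs ≡ suc i
  greedyRun-dyadicPrefix zero _ =
    _ , greedyRun-extend G z<s (m^n>0 2 k) P-prefix1 prefix1-maximal (done prefix0-empty) , refl
  greedyRun-dyadicPrefix (suc i) i<k with greedyRun-dyadicPrefix i (<⇒≤ i<k)
  ... | cs , run , length≡ =
    _ , greedyRun-extend G (^-monoʳ-< 2 (s≤s (s≤s z≤n)) (n<1+n i)) (^-monoʳ-≤ 2 i<k)
                           (P-block i<k) (block-maximal i<k) run ,
    cong suc length≡

  greedyRun-dyadic : Σ (List (Subset (2 ^ k))) λ cs → GreedyRun G P ⊤ cs × length cs ≡ suc k
  greedyRun-dyadic with greedyRun-dyadicPrefix k ≤-refl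
  ... | cs , run , length≡ =
    cs , subst (λ U → GreedyRun G P U cs) (sym (⊤≡prefix (2 ^ k))) run , length≡

SlowInstance : (Q : ∀ {n} → Graph n → Set) (Run : ∀ {n} → Graph n → List (Subset n) → Set) → ℕ → Set
SlowInstance Q Run k = Σ (Graph (2 ^ k)) λ G → IsDAG G × Q G ×
                       Σ (List (Subset (2 ^ k))) λ cs → Run G cs × length cs ≡ suc k

module _ {n : ℕ} (G : Graph n) where

  path-reach : ∀ {x xs y} → IsPath G (x ∷ xs) → y ∈ₗ x ∷ xs → Reach G x y
  path-reach _           (here refl) = ε
  path-reach (x→ ∷ path) (there y∈)  = x→ ◅ path-reach path y∈

  path-comparable : ∀ {p x y} → IsPath G p → x ∈ₗ p → y ∈ₗ p → Reach G x y ⊎ Reach G y x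
  path-comparable path (here refl) y∈          = inj₁ (path-reach path y∈)
  path-comparable path (there x∈)  (here refl) = inj₂ (path-reach path (there x∈))
  path-comparable path (there x∈)  (there y∈)  = path-comparable (Linked.tail path) x∈ y∈

  chain-comparable : ∀ {C u v} → IsChain G C → u ∈ C → v ∈ C → Reach G u v ⊎ Reach G v u
  chain-comparable (_ , path , covers) u∈ v∈ = path-comparable path (covers _ u∈) (covers _ v∈)

  insert : Fin n → List (Fin n) → List (Fin n)
  insert x []       = x ∷ []
  insert x (y ∷ ys) with x Fin.≟ y | G x y
  ... | yes _ | _     = y ∷ ys
  ... | no _  | true  = x ∷ y ∷ ys
  ... | no _  | false = y ∷ insert x ys

  insert-∈ : ∀ x ys → x ∈ₗ insert x ys
  insert-∈ x []       = here refl
  insert-∈ x (y ∷ ys) with x Fin.≟ y | G x y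
  ... | yes x≡y | _     = here x≡y
  ... | no _    | true  = here refl
  ... | no _    | false = there (insert-∈ x ys)

  insert-⊇ : ∀ x {y ys} → y ∈ₗ ys → y ∈ₗ insert x ys
  insert-⊇ x {ys = z ∷ ys} y∈ with x Fin.≟ z | G x z | y∈
  ... | yes _ | _     | _         = y∈
  ... | no _  | true  | _         = there y∈
  ... | no _  | false | here y≡z  = here y≡z
  ... | no _  | false | there y∈′ = there (insert-⊇ x y∈′)

  insertionSort : List (Fin n) → List (Fin n)
  insertionSort = foldr insert []

  insertionSort-⊇ : ∀ {x} xs → x ∈ₗ xs → x ∈ₗ insertionSort xs
  insertionSort-⊇ (x ∷ xs) (here refl) = insert-∈ x (insertionSort xs)
  insertionSort-⊇ (y ∷ xs) (there x∈)  = insert-⊇ y (insertionSort-⊇ xs x∈)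

  module _ {C : Fin n → Set}
           (tournament : ∀ {u v} → C u → C v → u ≢ v → Edge G u v ⊎ Edge G v u) where

    private
      edge-back : ∀ {x y} → C x → C y → x ≢ y → G x y ≡ false → Edge G y x
      edge-back Cx Cy x≢y x↛y with tournament Cx Cy x≢y
      ... | inj₁ x→y = case trans (sym x→y) x↛y of λ ()
      ... | inj₂ y→x = y→x

    insert-All : ∀ {x ys} → C x → All C ys → All C (insert x ys)
    insert-All {x} {[]}     Cx []         = Cx ∷ []
    insert-All {x} {y ∷ ys} Cx (Cy ∷ Cys) with x Fin.≟ y | G x y
    ... | yes _ | _     = Cy ∷ Cys
    ... | no _  | true  = Cx ∷ Cy ∷ Cys
    ... | no _  | false = Cy ∷ insert-All Cx Cys

    insert-path-after : ∀ {w x ys} → C x → All C ys → Edge G w x →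
                        IsPath G (w ∷ ys) → IsPath G (w ∷ insert x ys)
    insert-path-after {ys = []} Cx [] w→x _ = w→x ∷ [-]
    insert-path-after {x = x} {y ∷ ys} Cx (Cy ∷ Cys) w→x (w→y ∷ path) with x Fin.≟ y | G x y in x→y
    ... | yes _  | _     = w→y ∷ path
    ... | no _   | true  = w→x ∷ x→y ∷ path
    ... | no x≢y | false = w→y ∷ insert-path-after Cx Cys (edge-back Cx Cy x≢y x→y) path

    insert-path : ∀ {x ys} → C x → All C ys → IsPath G ys → IsPath G (insert x ys)
    insert-path {ys = []} Cx [] _ = [-]
    insert-path {x} {y ∷ ys} Cx (Cy ∷ Cys) path with x Fin.≟ y | G x y in x→y
    ... | yes _  | _     = path
    ... | no _   | true  = x→y ∷ path
    ... | no x≢y | false = insert-path-after Cx Cys (edge-back Cx Cy x≢y x→y) path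

    insertionSort-path : ∀ {xs} → All C xs → IsPath G (insertionSort xs) × All C (insertionSort xs)
    insertionSort-path []         = [] , []
    insertionSort-path (Cx ∷ Cxs) with insertionSort-path Cxs
    ... | path , Csorted = insert-path Cx Csorted path , insert-All Cx Csorted

  -- Rédei: a tournament has a Hamiltonian path, which insertion sort finds.
  tournament⇒chain : ∀ {C} → (∀ {u v} → u ∈ C → v ∈ C → u ≢ v → Edge G u v ⊎ Edge G v u) →
                     IsChain G C
  tournament⇒chain {C} tournament =
    insertionSort members ,
    proj₁ (insertionSort-path tournament (all-filter (_∈? C) (allFin n))) ,
    λ v v∈ → insertionSort-⊇ members (∈-filter⁺ (_∈? C) (∈-allFin v) v∈)
    where
    members : List (Fin n)
    members = filter (_∈? C) (allFin n)

-- The graph of a transitive relation on ℕ, restricted to {0, …, n - 1}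

module RelationGraph {n : ℕ} {R : ℕ → ℕ → Set} (R? : Decidable R) (R-trans : Transitive R) where

  graph : Graph n
  graph u v = does (R? (toℕ u) (toℕ v))

  edge⁺ : ∀ {u v} → R (toℕ u) (toℕ v) → Edge graph u v
  edge⁺ {u} {v} r with R? (toℕ u) (toℕ v)
  ... | yes _ = refl
  ... | no ¬r = contradiction r ¬r

  edge⁻ : ∀ {u v} → Edge graph u v → R (toℕ u) (toℕ v)
  edge⁻ {u} {v} e with R? (toℕ u) (toℕ v)
  ... | yes r = r

  reach⁻ : ∀ {u v} → Reach graph u v → u ≡ v ⊎ R (toℕ u) (toℕ v)
  reach⁻ ε = inj₁ refl
  reach⁻ (e ◅ path) with reach⁻ path
  ... | inj₁ refl = inj₂ (edge⁻ e)
  ... | inj₂ r    = inj₂ (R-trans (edge⁻ e) r)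

  transClosure⁻ : ∀ {u v} → TransClosure (Edge graph) u v → R (toℕ u) (toℕ v)
  transClosure⁻ [ e ]      = edge⁻ e
  transClosure⁻ (e ∷ path) = R-trans (edge⁻ e) (transClosure⁻ path)

  graph-dag : (∀ {a} → ¬ R a a) → IsDAG graph
  graph-dag R-irrefl v cycle = R-irrefl (transClosure⁻ cycle)

  chain⇒R-comparable : ∀ {C u v} → IsChain graph C → u ∈ C → v ∈ C →
                      u ≡ v ⊎ R (toℕ u) (toℕ v) ⊎ R (toℕ v) (toℕ u)
  chain⇒R-comparable chain u∈ v∈ with chain-comparable graph chain u∈ v∈
  ... | inj₁ u↝v = Sum.map₂ inj₁ (reach⁻ u↝v)
  ... | inj₂ v↝u = Sum.map sym inj₂ (reach⁻ v↝u)

  comparable⇒chain : ∀ {C} →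
                     (∀ {u v} → u ∈ C → v ∈ C → u ≢ v → R (toℕ u) (toℕ v) ⊎ R (toℕ v) (toℕ u)) →
                     IsChain graph C
  comparable⇒chain comparable =
    tournament⇒chain graph λ u∈ v∈ u≢v → Sum.map edge⁺ edge⁺ (comparable u∈ v∈ u≢v)

  incomparable⇒antichain : ∀ {A} → (∀ {u v} → u ∈ A → v ∈ A → u ≢ v → ¬ R (toℕ u) (toℕ v)) →
                           IsAntichain graph A
  incomparable⇒antichain incomparable u v u∈ v∈ u≢v u↝v with reach⁻ u↝v
  ... | inj₁ u≡v = u≢v u≡v
  ... | inj₂ r   = incomparable u∈ v∈ u≢v r

  chain-twinFree : ∀ {j C} → (∀ {a b} → IsTwin j a b → ¬ R a b × ¬ R b a) →
                   IsChain graph C → TwinFree j C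
  chain-twinFree twin-incomparable chain u∈ v∈ t with chain⇒R-comparable chain u∈ v∈
  ... | inj₁ u≡v      = twin-≢ t (cong toℕ u≡v)
  ... | inj₂ (inj₁ r) = proj₁ (twin-incomparable t) r
  ... | inj₂ (inj₂ r) = proj₂ (twin-incomparable t) r

  antichain-twinFree : ∀ {j A} → (∀ {a b} → IsTwin j a b → R a b ⊎ R b a) →
                       IsAntichain graph A → TwinFree j A
  antichain-twinFree twin-comparable antichain {u} {v} u∈ v∈ t with twin-comparable t
  ... | inj₁ r = antichain u v u∈ v∈ (twin-≢ t ∘ cong toℕ) (edge⁺ r ◅ ε)
  ... | inj₂ r = antichain v u v∈ u∈ (twin-≢ t ∘ sym ∘ cong toℕ) (edge⁺ r ◅ ε)

  chain-∣p∣≤colours : ∀ {h C} (colour : ℕ → Fin h) → (∀ {a b} → R a b → colour a ≢ colour b) →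
                      IsChain graph C → ∣ C ∣ ≤ h
  chain-∣p∣≤colours {C = C} colour proper chain =
    injectiveOn⇒∣p∣≤ C (λ {v} _ → colour (toℕ v)) injective
    where
    injective : ∀ {u v} (p : u ∈ C) (q : v ∈ C) → colour (toℕ u) ≡ colour (toℕ v) → u ≡ v
    injective p q e with chain⇒R-comparable chain p q
    ... | inj₁ u≡v      = u≡v
    ... | inj₂ (inj₁ r) = contradiction e (proper r)
    ... | inj₂ (inj₂ r) = contradiction (sym e) (proper r)

  antichain-∣p∣≤colours : ∀ {h A} (colour : ℕ → Fin h) →
                          (∀ {a b} → colour a ≡ colour b → a ≢ b → R a b ⊎ R b a) →
                          IsAntichain graph A → ∣ A ∣ ≤ h
  antichain-∣p∣≤colours {A = A} colour comparable antichain =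
    injectiveOn⇒∣p∣≤ A (λ {v} _ → colour (toℕ v)) injective
    where
    injective : ∀ {u v} (p : u ∈ A) (q : v ∈ A) → colour (toℕ u) ≡ colour (toℕ v) → u ≡ v
    injective {u} {v} p q e with u Fin.≟ v
    ... | yes u≡v = u≡v
    ... | no u≢v with comparable e (u≢v ∘ Fin.toℕ-injective)
    ...   | inj₁ r = ⊥-elim (antichain u v p q u≢v (edge⁺ r ◅ ε))
    ...   | inj₂ r = ⊥-elim (antichain v u q p (u≢v ∘ sym) (edge⁺ r ◅ ε))

  widthIs2 : 2 ≤ n → (∀ {a b} → IsTwin 0 a b → ¬ R a b × ¬ R b a) →
             (colour : ℕ → Fin 2) → (∀ {a b} → colour a ≡ colour b → a ≢ b → R a b ⊎ R b a) →
             WidthIs graph 2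
  widthIs2 2≤n twin-incomparable colour comparable =
    (prefix 2 , incomparable⇒antichain prefix2-incomparable , ∣interval∣ n z≤n 2≤n) ,
    λ A → antichain-∣p∣≤colours colour comparable
    where
    prefix2-incomparable : ∀ {u v} → u ∈ prefix 2 → v ∈ prefix 2 → u ≢ v → ¬ R (toℕ u) (toℕ v)
    prefix2-incomparable u∈ v∈ u≢v with prefix2-twins u∈ v∈ u≢v
    ... | inj₁ t = proj₁ (twin-incomparable t)
    ... | inj₂ t = proj₂ (twin-incomparable t)

  heightIs2 : 2 ≤ n → (∀ {a b} → IsTwin 0 a b → R a b ⊎ R b a) →
              (colour : ℕ → Fin 2) → (∀ {a b} → R a b → colour a ≢ colour b) →
              HeightIs graph 2
  heightIs2 2≤n twin-comparable colour proper =
    (prefix 2 , comparable⇒chain prefix2-comparable , ∣interval∣ n z≤n 2≤n) ,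
    λ C → chain-∣p∣≤colours colour proper
    where
    prefix2-comparable : ∀ {u v} → u ∈ prefix 2 → v ∈ prefix 2 → u ≢ v →
                         R (toℕ u) (toℕ v) ⊎ R (toℕ v) (toℕ u)
    prefix2-comparable u∈ v∈ u≢v with prefix2-twins u∈ v∈ u≢v
    ... | inj₁ t = twin-comparable t
    ... | inj₂ t = Sum.swap (twin-comparable t)

-- The chain family

module LevelOrder (level : ℕ → ℕ) (_≺_ : ℕ → ℕ → Set)
                  (≺-trans : Transitive _≺_) (≺-irrefl : ∀ {a} → ¬ a ≺ a) where

  data _⊏_ (a b : ℕ) : Set where
    far  : 2 + level b ≤ level a → a ⊏ b
    near : level b ≤ level a → a ≺ b → a ⊏ b

  ⊏⇒level≥ : ∀ {a b} → a ⊏ b → level b ≤ level a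
  ⊏⇒level≥ {b = b} (far p)    = ≤-trans (m≤n+m (level b) 2) p
  ⊏⇒level≥         (near p _) = p

  ⊏-trans : Transitive _⊏_
  ⊏-trans (far p)      b⊏c          = far (≤-trans (+-monoʳ-≤ 2 (⊏⇒level≥ b⊏c)) p)
  ⊏-trans (near p _)   (far q)      = far (≤-trans q p)
  ⊏-trans (near p a≺b) (near q b≺c) = near (≤-trans q p) (≺-trans a≺b b≺c)

  ⊏-irrefl : ∀ {a} → ¬ a ⊏ a
  ⊏-irrefl (far p)      = 1+n≰n (≤-trans (n≤1+n _) p)
  ⊏-irrefl (near _ a≺a) = ≺-irrefl a≺a

  ⊏-dec : Decidable _≺_ → Decidable _⊏_
  ⊏-dec _≺?_ a b = map′ Sum.[ far , uncurry near ] split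
                        ((2 + level b ≤? level a) ⊎-dec ((level b ≤? level a) ×-dec (a ≺? b)))
    where
    split : a ⊏ b → 2 + level b ≤ level a ⊎ (level b ≤ level a × a ≺ b)
    split (far p)      = inj₁ p
    split (near p a≺b) = inj₂ (p , a≺b)

  ⊏-incomparable : ∀ {a b} → level b ≡ suc (level a) → a ≺ b → ¬ a ⊏ b × ¬ b ⊏ a
  ⊏-incomparable {a} {b} lb≡ a≺b = a⋢b , b⋢a
    where
    a⋢b : ¬ a ⊏ b
    a⋢b a⊏b = 1+n≰n (subst (_≤ level a) lb≡ (⊏⇒level≥ a⊏b))
    b⋢a : ¬ b ⊏ a
    b⋢a (far p)      = 1+n≰n (subst (2 + level a ≤_) lb≡ p)
    b⋢a (near _ b≺a) = ≺-irrefl (≺-trans a≺b b≺a)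

  ⊏-comparable : (∀ {a b} → a ≢ b → a ≺ b ⊎ b ≺ a) →
                 ∀ {a b} → parity (level a) ≡ parity (level b) → a ≢ b → a ⊏ b ⊎ b ⊏ a
  ⊏-comparable ≺-total same-parity a≢b with parity-gap same-parity
  ... | inj₂ (inj₁ 2+la≤lb) = inj₂ (far 2+la≤lb)
  ... | inj₂ (inj₂ 2+lb≤la) = inj₁ (far 2+lb≤la)
  ... | inj₁ la≡lb with ≺-total a≢b
  ...   | inj₁ a≺b = inj₁ (near (≤-reflexive (sym la≡lb)) a≺b)
  ...   | inj₂ b≺a = inj₂ (near (≤-reflexive la≡lb) b≺a)

module ChainGraph (K : ℕ) where

  private
    pop len : ℕ → ℕ
    pop = popcount K
    len = bitLength K

  data _≺_ (a b : ℕ) : Set where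
    len<   : len a < len b → a ≺ b
    pop>   : len a ≡ len b → pop b < pop a → a ≺ b
    value< : len a ≡ len b → pop a ≡ pop b → a < b → a ≺ b

  ≺-trans : Transitive _≺_
  ≺-trans (len< p)         (len< q)         = len< (<-trans p q)
  ≺-trans (len< p)         (pop> q _)       = len< (subst (_ <_) q p)
  ≺-trans (len< p)         (value< q _ _)   = len< (subst (_ <_) q p)
  ≺-trans (pop> p _)       (len< q)         = len< (subst (_< _) (sym p) q)
  ≺-trans (value< p _ _)   (len< q)         = len< (subst (_< _) (sym p) q)
  ≺-trans (pop> p p′)      (pop> q q′)      = pop> (trans p q) (<-trans q′ p′)
  ≺-trans (pop> p p′)      (value< q q′ _)  = pop> (trans p q) (subst (_< _) q′ p′)
  ≺-trans (value< p p′ _)  (pop> q q′)      = pop> (trans p q) (subst (_ <_) (sym p′) q′)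
  ≺-trans (value< p p′ p″) (value< q q′ q″) = value< (trans p q) (trans p′ q′) (<-trans p″ q″)

  ≺-irrefl : ∀ {a} → ¬ a ≺ a
  ≺-irrefl (len< p)       = n≮n _ p
  ≺-irrefl (pop> _ p)     = n≮n _ p
  ≺-irrefl (value< _ _ p) = n≮n _ p

  ≺-total : ∀ {a b} → a ≢ b → a ≺ b ⊎ b ≺ a
  ≺-total {a} {b} a≢b with <-cmp (len a) (len b) | <-cmp (pop b) (pop a) | <-cmp a b
  ... | tri< l< _ _ | _           | _            = inj₁ (len< l<)
  ... | tri> _ _ l> | _           | _            = inj₂ (len< l>)
  ... | tri≈ _ l≡ _ | tri< p< _ _ | _            = inj₁ (pop> l≡ p<)
  ... | tri≈ _ l≡ _ | tri> _ _ p> | _            = inj₂ (pop> (sym l≡) p>)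
  ... | tri≈ _ l≡ _ | tri≈ _ p≡ _ | tri< a<b _ _ = inj₁ (value< l≡ (sym p≡) a<b)
  ... | tri≈ _ _  _ | tri≈ _ _  _ | tri≈ _ a≡b _ = contradiction a≡b a≢b
  ... | tri≈ _ l≡ _ | tri≈ _ p≡ _ | tri> _ _ b<a = inj₂ (value< (sym l≡) p≡ b<a)

  _≺?_ : Decidable _≺_
  a ≺? b with a ≟ b
  ... | yes refl = no ≺-irrefl
  ... | no a≢b with ≺-total a≢b
  ...   | inj₁ a≺b = yes a≺b
  ...   | inj₂ b≺a = no λ a≺b → ≺-irrefl (≺-trans a≺b b≺a)

  ≺-sameLength : ∀ {a b} → len a ≡ len b → a ≺ b → pop b ≤ pop a
  ≺-sameLength l≡ (len< l<)       = contradiction l≡ (<⇒≢ l<)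
  ≺-sameLength _  (pop> _ p<)     = <⇒≤ p<
  ≺-sameLength _  (value< _ p≡ _) = ≤-reflexive (sym p≡)

  twin-≺ : ∀ {j a b} → j < K → IsTwin j a b → a ≺ b
  twin-≺ j<K t@(twin a<2^j) =
    len< (subst (len _ <_) (sym (bitLength-twin K j<K t)) (s≤s (bitLength-≤ K a<2^j)))

  open LevelOrder pop _≺_ ≺-trans ≺-irrefl public

  twin-incomparable : ∀ {j a b} → j < K → IsTwin j a b → ¬ a ⊏ b × ¬ b ⊏ a
  twin-incomparable j<K t = ⊏-incomparable (popcount-twin K j<K t) (twin-≺ j<K t)

  sameLength-comparable : ∀ {a b} → len a ≡ len b → a ≢ b → a ⊏ b ⊎ b ⊏ a
  sameLength-comparable len≡ a≢b with ≺-total a≢b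
  ... | inj₁ a≺b = inj₁ (near (≺-sameLength len≡ a≺b) a≺b)
  ... | inj₂ b≺a = inj₂ (near (≺-sameLength (sym len≡) b≺a) b≺a)

  open RelationGraph {2 ^ K} (⊏-dec _≺?_) ⊏-trans public

  block-chain : ∀ {j} → j < K → IsChain graph (dyadicBlock j)
  block-chain {j} j<K = comparable⇒chain λ u∈ v∈ u≢v →
    let (2^j≤u , u<) = ∈-interval⁻ (2 ^ j) (2 ^ suc j) u∈
        (2^j≤v , v<) = ∈-interval⁻ (2 ^ j) (2 ^ suc j) v∈
    in sameLength-comparable
         (trans (bitLength-block K j<K 2^j≤u u<) (sym (bitLength-block K j<K 2^j≤v v<)))
         (u≢v ∘ Fin.toℕ-injective)

  slowInstance : 0 < K → SlowInstance (λ G → WidthIs G 2) GreedyChainRun K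
  slowInstance 0<K =
    graph , graph-dag ⊏-irrefl ,
    widthIs2 (^-monoʳ-≤ 2 0<K) (twin-incomparable 0<K) (parity ∘ pop) (⊏-comparable ≺-total) ,
    greedyRun-dyadic graph
      (comparable⇒chain λ u∈ v∈ u≢v → contradiction (prefix1-unique u∈ v∈) u≢v)
      block-chain
      (λ j<K → chain-twinFree (twin-incomparable j<K))

-- The antichain family

module AntichainGraph (K : ℕ) where

  private
    pop : ℕ → ℕ
    pop = popcount K

  Extends : ℕ → ℕ → Set
  Extends a b = ∃ λ (i : Fin K) → IsTwin (toℕ i) a b

  data _⇀_ (a b : ℕ) : Set where
    edge : parity (pop a) ≡ zero → parity (pop b) ≡ suc zero → Extends a b ⊎ Extends b a → a ⇀ b

  _⇀?_ : Decidable _⇀_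
  a ⇀? b = map′ (λ (pa , pb , ext) → edge pa pb ext) (λ { (edge pa pb ext) → pa , pb , ext })
                ((parity (pop a) Fin.≟ zero) ×-dec (parity (pop b) Fin.≟ suc zero) ×-dec
                 (extends? a b ⊎-dec extends? b a))
    where
    extends? : Decidable Extends
    extends? a b = Fin.any? λ i → isTwin? (toℕ i) a b

  ⇀-parity : ∀ {a b} → a ⇀ b → parity (pop a) ≢ parity (pop b)
  ⇀-parity (edge pa pb _) e = Fin.0≢1+n (trans (sym pa) (trans e pb))

  -- vacuously: an edge ends at odd popcount and starts at even popcount
  ⇀-trans : Transitive _⇀_
  ⇀-trans (edge _ pb _) (edge pb′ _ _) = contradiction (trans (sym pb′) pb) Fin.0≢1+n

  ⇀-irrefl : ∀ {a} → ¬ a ⇀ a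
  ⇀-irrefl a⇀a = ⇀-parity a⇀a refl

  twin⇒extends : ∀ {j a b} → j < K → IsTwin j a b → Extends a b
  twin⇒extends j<K t = fromℕ< j<K , subst (λ i → IsTwin i _ _) (sym (Fin.toℕ-fromℕ< j<K)) t

  twin-comparable : ∀ {j a b} → j < K → IsTwin j a b → a ⇀ b ⊎ b ⇀ a
  twin-comparable {a = a} j<K t with parity-suc (pop a)
  ... | inj₁ (pa , pb) =
    inj₁ (edge pa (trans (cong parity (popcount-twin K j<K t)) pb) (inj₁ (twin⇒extends j<K t)))
  ... | inj₂ (pa , pb) =
    inj₂ (edge (trans (cong parity (popcount-twin K j<K t)) pb) pa (inj₂ (twin⇒extends j<K t)))

  block-incomparable : ∀ j {a b} → 2 ^ j ≤ a → a < 2 ^ suc j → 2 ^ j ≤ b → b < 2 ^ suc j → ¬ a ⇀ b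
  block-incomparable j 2^j≤a a< 2^j≤b b< (edge _ _ (inj₁ (_ , t))) = twin-escapes-block j 2^j≤a b< t
  block-incomparable j 2^j≤a a< 2^j≤b b< (edge _ _ (inj₂ (_ , t))) = twin-escapes-block j 2^j≤b a< t

  open RelationGraph {2 ^ K} _⇀?_ ⇀-trans public

  block-antichain : ∀ {j} → j < K → IsAntichain graph (dyadicBlock j)
  block-antichain {j} _ = incomparable⇒antichain λ u∈ v∈ _ →
    let (2^j≤u , u<) = ∈-interval⁻ (2 ^ j) (2 ^ suc j) u∈
        (2^j≤v , v<) = ∈-interval⁻ (2 ^ j) (2 ^ suc j) v∈
    in block-incomparable j 2^j≤u u< 2^j≤v v<

  slowInstance : 0 < K → SlowInstance (λ G → HeightIs G 2) GreedyAntichainRun K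
  slowInstance 0<K =
    graph , graph-dag ⇀-irrefl ,
    heightIs2 (^-monoʳ-≤ 2 0<K) (twin-comparable 0<K) (parity ∘ pop) ⇀-parity ,
    greedyRun-dyadic graph
      (incomparable⇒antichain λ u∈ v∈ u≢v → contradiction (prefix1-unique u∈ v∈) u≢v)
      block-antichain
      (λ j<K → antichain-twinFree (twin-comparable j<K))

unbounded : {Q : ∀ {n} → Graph n → Set} {Run : ∀ {n} → Graph n → List (Subset n) → Set} →
            (∀ k → SlowInstance Q Run (suc k)) →
            (m : ℕ) → Σ ℕ λ n → m ≤ n × Σ (Graph n) λ G → IsDAG G × Q G
              × Σ (List (Subset n)) λ cs → Run G cs × n ≤ 2 ^ length cs
unbounded slow m with slow m
... | G , dag , q , cs , run , length≡ =
  2 ^ suc m , ≤-trans (<⇒≤ (n<2^n m)) (^-monoʳ-≤ 2 (n≤1+n m)) , G , dag , q , cs , run ,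
  subst (λ l → 2 ^ suc m ≤ 2 ^ l) (sym length≡) (^-monoʳ-≤ 2 (n≤1+n (suc m)))

theorem5 : ((m : ℕ) → Σ ℕ λ n → m ≤ n × Σ (Graph n) λ G → IsDAG G × WidthIs G 2
             × Σ (List (Subset n)) λ cs → GreedyChainRun G cs × n ≤ 2 ^ length cs)
           × ((m : ℕ) → Σ ℕ λ n → m ≤ n × Σ (Graph n) λ G → IsDAG G × HeightIs G 2
             × Σ (List (Subset n)) λ cs → GreedyAntichainRun G cs × n ≤ 2 ^ length cs)
theorem5 = unbounded (λ k → ChainGraph.slowInstance (suc k) z<s) ,
           unbounded (λ k → AntichainGraph.slowInstance (suc k) z<s)
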